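{- Let $F(t)=\frac{1}{2}(t^2-t+1)$ and $G(t)=\frac{1}{2}(t^2+t+1)=F(-t)$. Let $f,g\in\mathbb{Q}[t]$ with $\deg f=\deg g=2$, and call $(f,g)$ a solution if $g$ divides $f^3+1$ and $f$ divides $g^3+1$ in $\mathbb{Q}[t]$. Call $(f,g)$ trivial if there exist $f_1,g_1,h\in\mathbb{Q}[t]$ with $\deg h\ge 2$ such that $f=f_1\circ h$ and $g=g_1\circ h$. Then $(f,g)$ is a non-trivial solution if and only if there exist $\alpha\in\mathbb{Q}\setminus\{0\}$ and $\beta\in\mathbb{Q}$ such that $f(t)=F(\alpha t+\beta)$ and $g(t)=G(\alpha t+\beta)$.
   Context: Non-trivial solutions are considered only up to affine reparametrization $t\mapsto \alpha t+\beta$ with $\alpha\in\mathbb{Q}\setminus\{0\}$, $\beta\in\mathbb{Q}$; this is how the paper's normalization of non-trivial solutions (no composition with a polynomial of degree at least $2$, and normalization of the linear substitution) is expressed here. -}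

module Defs where

open import Data.Nat using (ℕ; zero; suc; _≥_)
open import Data.List using (List; []; _∷_)
open import Data.Product using (Σ; ∃; _×_; _,_)
open import Data.Rational using (ℚ; 0ℚ; 1ℚ; ½; -_) renaming (_+_ to _+ℚ_; _*_ to _*ℚ_)
open import Relation.Binary.PropositionalEquality using (_≡_; _≢_)
open import Relation.Nullary using (¬_)

-- Univariate polynomials over ℚ, represented by coefficient lists,
-- lowest degree first: a₀ ∷ a₁ ∷ … represents a₀ + a₁ t + …
-- Trailing zeros are allowed; polynomial equality is coefficientwise (_≈_).
Poly : Set
Poly = List ℚ

coeff : Poly → ℕ → ℚ
coeff []       _       = 0ℚ
coeff (a ∷ p)  zero    = a
coeff (a ∷ p)  (suc n) = coeff p n

infix 4 _≈_
_≈_ : Poly → Poly → Set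
p ≈ q = ∀ n → coeff p n ≡ coeff q n

infixl 6 _⊕_
_⊕_ : Poly → Poly → Poly
[]      ⊕ q       = q
(a ∷ p) ⊕ []      = a ∷ p
(a ∷ p) ⊕ (b ∷ q) = (a +ℚ b) ∷ (p ⊕ q)

scale : ℚ → Poly → Poly
scale c []      = []
scale c (a ∷ p) = (c *ℚ a) ∷ scale c p

infixl 7 _⊛_
_⊛_ : Poly → Poly → Poly
[]      ⊛ q = []
(a ∷ p) ⊛ q = scale a q ⊕ (0ℚ ∷ (p ⊛ q))

infixr 9 _∘ₚ_
_∘ₚ_ : Poly → Poly → Poly
[]      ∘ₚ h = []
(a ∷ p) ∘ₚ h = (a ∷ []) ⊕ (h ⊛ (p ∘ₚ h))

one : Poly
one = 1ℚ ∷ []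

HasDegree : Poly → ℕ → Set
HasDegree p d = coeff p d ≢ 0ℚ × (∀ n → n Data.Nat.> d → coeff p n ≡ 0ℚ)

DegreeAtLeast2 : Poly → Set
DegreeAtLeast2 p = ∃ λ n → n ≥ 2 × coeff p n ≢ 0ℚ

infix 4 _∣ₚ_
_∣ₚ_ : Poly → Poly → Set
g ∣ₚ p = ∃ λ q → p ≈ g ⊛ q

cube : Poly → Poly
cube f = f ⊛ f ⊛ f

IsSolution : Poly → Poly → Set
IsSolution f g = (g ∣ₚ (cube f ⊕ one)) × (f ∣ₚ (cube g ⊕ one))

IsTrivial : Poly → Poly → Set
IsTrivial f g = Σ Poly λ f₁ → Σ Poly λ g₁ → Σ Poly λ h →
  DegreeAtLeast2 h × (f ≈ f₁ ∘ₚ h) × (g ≈ g₁ ∘ₚ h)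

Fpoly : Poly
Fpoly = ½ ∷ (- ½) ∷ ½ ∷ []

Gpoly : Poly
Gpoly = ½ ∷ ½ ∷ ½ ∷ []

lin : ℚ → ℚ → Poly
lin α β = β ∷ α ∷ []

-- Reduce modulo g: writing g = k₂ (t² + c₁ t + c₀), work in K = ℚ[θ]/(θ² + c₁θ + c₀).  The
-- image u = X + Yθ of f satisfies u³ = −1.  If u = −1, then f + 1 and g are both multiples of
-- t² + c₁ t + c₀, so (f , g) is trivial.  Otherwise Y ≠ 0 and u is a root of t² − t + 1, i.e.
-- trace u = norm u = 1.  Doing the same for g modulo f gives four polynomial equations in the
-- coefficients, which force f and g to have the same leading coefficient Y²/2; then
-- f = F(−Yt − X) and g = G(−Yt − X).  Conversely F(αt + β) and G(αt + β) divide each other's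
-- cube plus one with explicit cofactors.  If both were compositions with a common h of degree
-- ≥ 2, degrees would make h quadratic and the outer polynomials linear; their t²-coefficients
-- show that the outer polynomials have the same slope, so the t-coefficients α(β − ½) and
-- α(β + ½) agree, i.e. α = 0.

module Submission where

open import Defs
open import Data.Product using (Σ; _×_)
open import Data.Rational using (ℚ; 0ℚ)
open import Function.Bundles using (_⇔_)
open import Relation.Binary.PropositionalEquality using (_≢_)
open import Relation.Nullary using (¬_)

open import Data.Empty using (⊥-elim)
open import Data.Integer using (+_)
open import Data.List using (List; []; _∷_; map)
open import Data.Nat as ℕ using (ℕ; zero; suc; _<_; _≤_; z≤n; s≤s)
import Data.Nat.Properties as ℕ
open import Data.Product using (_,_; proj₁; proj₂)
open import Data.Rational using (1ℚ; ½; -_; _/_; _+_; _*_; _-_; 1/_; ≢-nonZero; nonNegative; nonPositive)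
import Data.Rational as ℚ
import Data.Rational.Properties as ℚ
open import Data.Rational.Solver using (module +-*-Solver)
open import Data.Sum using (_⊎_; inj₁; inj₂; [_,_]′)
open import Function.Base using (_∘_; id)
open import Function.Bundles using (mk⇔)
open import Relation.Binary.Definitions using (tri<; tri≈; tri>)
open import Relation.Binary.PropositionalEquality using (_≡_; refl; sym; trans; cong; cong₂; subst; module ≡-Reasoning)
open import Relation.Nullary using (yes; no)
open +-*-Solver using (solve; _:=_; con; Polynomial; _:+_; _:*_; _:-_; :-_)

open ≡-Reasoning

x-y≡0⇒x≡y : ∀ x y → x - y ≡ 0ℚ → x ≡ y
x-y≡0⇒x≡y = x∙y⁻¹≈ε⇒x≈y
  where
  open import Algebra.Properties.Group ℚ.+-0-group using (x∙y⁻¹≈ε⇒x≈y)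

x*y≡0⇒x≡0∨y≡0 : ∀ x y → x * y ≡ 0ℚ → x ≡ 0ℚ ⊎ y ≡ 0ℚ
x*y≡0⇒x≡0∨y≡0 x y xy≡0 with x ℚ.≟ 0ℚ
... | yes x≡0 = inj₁ x≡0
... | no x≢0 = inj₂ (begin
  y               ≡⟨ sym (ℚ.*-identityˡ y) ⟩
  1ℚ * y          ≡⟨ cong (_* y) (sym (ℚ.*-inverseˡ x)) ⟩
  1/ x * x * y    ≡⟨ ℚ.*-assoc (1/ x) x y ⟩
  1/ x * (x * y)  ≡⟨ cong (1/ x *_) xy≡0 ⟩
  1/ x * 0ℚ       ≡⟨ ℚ.*-zeroʳ (1/ x) ⟩
  0ℚ              ∎)
  where instance _ = ≢-nonZero x≢0

x≢0∧y≢0⇒x*y≢0 : ∀ {x y} → x ≢ 0ℚ → y ≢ 0ℚ → x * y ≢ 0ℚ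
x≢0∧y≢0⇒x*y≢0 x≢0 y≢0 xy≡0 = [ x≢0 , y≢0 ]′ (x*y≡0⇒x≡0∨y≡0 _ _ xy≡0)

*-cancelˡ-≡ : ∀ x {y z} → x ≢ 0ℚ → x * y ≡ x * z → y ≡ z
*-cancelˡ-≡ x {y} {z} x≢0 xy≡xz = x-y≡0⇒x≡y y z
  ([ ⊥-elim ∘ x≢0 , id ]′ (x*y≡0⇒x≡0∨y≡0 x (y - z) x[y-z]≡0))
  where
  x[y-z]≡0 : x * (y - z) ≡ 0ℚ
  x[y-z]≡0 = begin
    x * (y - z)    ≡⟨ solve 3 (λ x y z → x :* (y :- z) := x :* y :- x :* z) refl x y z ⟩
    x * y - x * z  ≡⟨ cong (_- x * z) xy≡xz ⟩
    x * z - x * z  ≡⟨ ℚ.+-inverseʳ (x * z) ⟩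
    0ℚ             ∎

x*x≥0 : ∀ x → 0ℚ ℚ.≤ x * x
x*x≥0 x with ℚ.≤-total 0ℚ x
... | inj₁ 0≤x = ℚ.nonNegative⁻¹ (x * x) {{ℚ.nonNeg*nonNeg⇒nonNeg x {{nonNegative 0≤x}} x {{nonNegative 0≤x}}}}
... | inj₂ x≤0 = ℚ.nonNegative⁻¹ (x * x) {{ℚ.nonPos*nonPos⇒nonPos x {{nonPositive x≤0}} x {{nonPositive x≤0}}}}

x²+x+1≢0 : ∀ x → x * x + x + 1ℚ ≢ 0ℚ
-- 0 ≤ −¾ is refuted by computing its boolean test ≤ᵇ
x²+x+1≢0 x eq = ℚ.≤⇒≤ᵇ (subst (0ℚ ℚ.≤_) [x+½]²≡-¾ (x*x≥0 (x + ½)))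
  where
  -¾ : ℚ
  -¾ = - (½ + ½ * ½)
  [x+½]²≡-¾ : (x + ½) * (x + ½) ≡ -¾
  [x+½]²≡-¾ = begin
    (x + ½) * (x + ½)           ≡⟨ solve 1 (λ x → (x :+ con ½) :* (x :+ con ½) := (x :* x :+ x :+ con 1ℚ) :+ con -¾) refl x ⟩
    (x * x + x + 1ℚ) + -¾      ≡⟨ cong (_+ -¾) eq ⟩
    0ℚ + -¾                     ≡⟨ ℚ.+-identityˡ -¾ ⟩
    -¾                          ∎

x³≡1⇒x≡1 : ∀ x → x * x * x ≡ 1ℚ → x ≡ 1ℚ
x³≡1⇒x≡1 x x³≡1 = [ x-y≡0⇒x≡y x 1ℚ , ⊥-elim ∘ x²+x+1≢0 x ]′
  (x*y≡0⇒x≡0∨y≡0 (x - 1ℚ) (x * x + x + 1ℚ) (begin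
    (x - 1ℚ) * (x * x + x + 1ℚ)  ≡⟨ solve 1 (λ x → (x :- con 1ℚ) :* (x :* x :+ x :+ con 1ℚ) := x :* x :* x :- con 1ℚ) refl x ⟩
    x * x * x - 1ℚ               ≡⟨ cong (_- 1ℚ) x³≡1 ⟩
    1ℚ - 1ℚ                      ≡⟨ ℚ.+-inverseʳ 1ℚ ⟩
    0ℚ                           ∎))

x³+1≡0⇒x≡-1 : ∀ x → x * x * x + 1ℚ ≡ 0ℚ → x ≡ - 1ℚ
x³+1≡0⇒x≡-1 x x³+1≡0 = begin
  x        ≡⟨ solve 1 (λ x → x := :- (:- x)) refl x ⟩
  - (- x)  ≡⟨ cong -_ (x³≡1⇒x≡1 (- x) (begin
    - x * - x * - x          ≡⟨ solve 1 (λ x → (:- x) :* (:- x) :* (:- x) := con 1ℚ :- (x :* x :* x :+ con 1ℚ)) refl x ⟩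
    1ℚ - (x * x * x + 1ℚ)    ≡⟨ cong (λ z → 1ℚ - z) x³+1≡0 ⟩
    1ℚ                       ∎)) ⟩
  - 1ℚ     ∎

lincomb₁ : ∀ {A B P Q} → P ≡ Q → ∀ k → A - B ≡ k * (P - Q) → A ≡ B
lincomb₁ {A} {B} {P} refl k A-B≡k[P-P] = x-y≡0⇒x≡y A B
  (trans A-B≡k[P-P] (solve 2 (λ k P → k :* (P :- P) := con 0ℚ) refl k P))

lincomb₂ : ∀ {A B P Q R S} → P ≡ Q → R ≡ S → ∀ k l → A - B ≡ k * (P - Q) + l * (R - S) → A ≡ B
lincomb₂ {A} {B} {P} {R = R} refl refl k l A-B≡… = x-y≡0⇒x≡y A B
  (trans A-B≡… (solve 4 (λ k P l R → k :* (P :- P) :+ l :* (R :- R) := con 0ℚ) refl k P l R))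

lincomb₃ : ∀ {A B P Q R S U V} → P ≡ Q → R ≡ S → U ≡ V → ∀ k l m →
  A - B ≡ k * (P - Q) + l * (R - S) + m * (U - V) → A ≡ B
lincomb₃ {A} {B} {P} {R = R} {U = U} refl refl refl k l m A-B≡… = x-y≡0⇒x≡y A B
  (trans A-B≡… (solve 6 (λ k P l R m U → k :* (P :- P) :+ l :* (R :- R) :+ m :* (U :- U) := con 0ℚ) refl k P l R m U))

*-cancel-inverse : ∀ k a .{{_ : ℚ.NonZero k}} → k * (a * 1/ k) ≡ a
*-cancel-inverse k a = begin
  k * (a * 1/ k)  ≡⟨ solve 3 (λ k a w → k :* (a :* w) := a :* (k :* w)) refl k a (1/ k) ⟩
  a * (k * 1/ k)  ≡⟨ cong (a *_) (ℚ.*-inverseʳ k) ⟩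
  a * 1ℚ          ≡⟨ ℚ.*-identityʳ a ⟩
  a               ∎

-- Copies of the operations of Defs (and of trace and norm below) on ring-solver expressions.
-- Evaluating a copy with ⟦_⟧ reduces to the original operation, so an identity between
-- coefficients of explicitly given polynomials is a goal for the ring solver.
module _ {n : ℕ} where
  infixl 6 _⊕ₛ_
  infixl 7 _⊛ₛ_
  infixr 9 _∘ₛ_

  coeffₛ : List (Polynomial n) → ℕ → Polynomial n
  coeffₛ []      _       = con 0ℚ
  coeffₛ (a ∷ p) zero    = a
  coeffₛ (a ∷ p) (suc k) = coeffₛ p k

  _⊕ₛ_ : List (Polynomial n) → List (Polynomial n) → List (Polynomial n)
  []      ⊕ₛ q       = q
  (a ∷ p) ⊕ₛ []      = a ∷ p
  (a ∷ p) ⊕ₛ (b ∷ q) = (a :+ b) ∷ (p ⊕ₛ q)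

  scaleₛ : Polynomial n → List (Polynomial n) → List (Polynomial n)
  scaleₛ c []      = []
  scaleₛ c (a ∷ p) = (c :* a) ∷ scaleₛ c p

  _⊛ₛ_ : List (Polynomial n) → List (Polynomial n) → List (Polynomial n)
  []      ⊛ₛ q = []
  (a ∷ p) ⊛ₛ q = scaleₛ a q ⊕ₛ (con 0ℚ ∷ (p ⊛ₛ q))

  _∘ₛ_ : List (Polynomial n) → List (Polynomial n) → List (Polynomial n)
  []      ∘ₛ h = []
  (a ∷ p) ∘ₛ h = (a ∷ []) ⊕ₛ (h ⊛ₛ (p ∘ₛ h))

  ⌜_⌝ : Poly → List (Polynomial n)
  ⌜_⌝ = map con

traceₛ : ∀ {n} → Polynomial n → Polynomial n × Polynomial n → Polynomial n
traceₛ c₁ (x , y) = x :+ x :- c₁ :* y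

normₛ : ∀ {n} → Polynomial n → Polynomial n → Polynomial n × Polynomial n → Polynomial n
normₛ c₀ c₁ (x , y) = x :* x :- c₁ :* (x :* y) :+ c₀ :* (y :* y)

-- _≈_ wrapped in a record, so that Agda can infer the two polynomials from the type
infix 4 _≋_
record _≋_ (p q : Poly) : Set where
  constructor from≈
  field to≈ : p ≈ q
open _≋_

≋-refl : ∀ {p} → p ≋ p
≋-refl = from≈ λ n → refl

≋-sym : ∀ {p q} → p ≋ q → q ≋ p
≋-sym (from≈ p≈q) = from≈ λ n → sym (p≈q n)

≋-trans : ∀ {p q r} → p ≋ q → q ≋ r → p ≋ r
≋-trans (from≈ p≈q) (from≈ q≈r) = from≈ λ n → trans (p≈q n) (q≈r n)

∷-cong : ∀ {a b p q} → a ≡ b → p ≋ q → a ∷ p ≋ b ∷ q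
∷-cong a≡b p≋q = from≈ λ { zero → a≡b ; (suc n) → to≈ p≋q n }

∷-≋[] : ∀ {a p} → a ≡ 0ℚ → p ≋ [] → a ∷ p ≋ []
∷-≋[] a≡0 p≋[] = from≈ λ { zero → a≡0 ; (suc n) → to≈ p≋[] n }

tail-≋ : ∀ {a b p q} → a ∷ p ≋ b ∷ q → p ≋ q
tail-≋ a∷p≋b∷q = from≈ (to≈ a∷p≋b∷q ∘ suc)

tail-≋[] : ∀ {a p} → a ∷ p ≋ [] → p ≋ []
tail-≋[] a∷p≋[] = from≈ (to≈ a∷p≋[] ∘ suc)

coeff-⊕ : ∀ p q n → coeff (p ⊕ q) n ≡ coeff p n + coeff q n
coeff-⊕ []      q       n       = sym (ℚ.+-identityˡ _)
coeff-⊕ (a ∷ p) []      n       = sym (ℚ.+-identityʳ _)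
coeff-⊕ (a ∷ p) (b ∷ q) zero    = refl
coeff-⊕ (a ∷ p) (b ∷ q) (suc n) = coeff-⊕ p q n

coeff-scale : ∀ c p n → coeff (scale c p) n ≡ c * coeff p n
coeff-scale c []      n       = sym (ℚ.*-zeroʳ c)
coeff-scale c (a ∷ p) zero    = refl
coeff-scale c (a ∷ p) (suc n) = coeff-scale c p n

⊕-cong : ∀ {p p′ q q′} → p ≋ p′ → q ≋ q′ → p ⊕ q ≋ p′ ⊕ q′
⊕-cong {p} {p′} {q} {q′} (from≈ p≈p′) (from≈ q≈q′) = from≈ λ n → begin
  coeff (p ⊕ q) n          ≡⟨ coeff-⊕ p q n ⟩
  coeff p n + coeff q n    ≡⟨ cong₂ _+_ (p≈p′ n) (q≈q′ n) ⟩
  coeff p′ n + coeff q′ n  ≡⟨ coeff-⊕ p′ q′ n ⟨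
  coeff (p′ ⊕ q′) n        ∎

⊕-identityʳ : ∀ p → p ⊕ [] ≋ p
⊕-identityʳ []      = ≋-refl
⊕-identityʳ (a ∷ p) = ≋-refl

scale-cong : ∀ {a b p q} → a ≡ b → p ≋ q → scale a p ≋ scale b q
scale-cong {a} {b} {p} {q} a≡b (from≈ p≈q) = from≈ λ n → begin
  coeff (scale a p) n  ≡⟨ coeff-scale a p n ⟩
  a * coeff p n        ≡⟨ cong₂ _*_ a≡b (p≈q n) ⟩
  b * coeff q n        ≡⟨ coeff-scale b q n ⟨
  coeff (scale b q) n  ∎

scale-zeroˡ : ∀ p → scale 0ℚ p ≋ []
scale-zeroˡ p = from≈ λ n → trans (coeff-scale 0ℚ p n) (ℚ.*-zeroˡ (coeff p n))

⊛-zeroˡ : ∀ {p} q → p ≋ [] → p ⊛ q ≋ []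
⊛-zeroˡ {[]}    q p≋[] = ≋-refl
⊛-zeroˡ {a ∷ p} q p≋[] = ⊕-cong
  (≋-trans (scale-cong (to≈ p≋[] 0) ≋-refl) (scale-zeroˡ q))
  (∷-≋[] refl (⊛-zeroˡ q (tail-≋[] p≋[])))

⊛-zeroʳ : ∀ p → p ⊛ [] ≋ []
⊛-zeroʳ []      = ≋-refl
⊛-zeroʳ (a ∷ p) = ∷-≋[] refl (⊛-zeroʳ p)

⊛-congʳ : ∀ p {q q′} → q ≋ q′ → p ⊛ q ≋ p ⊛ q′
⊛-congʳ []      q≋q′ = ≋-refl
⊛-congʳ (a ∷ p) q≋q′ = ⊕-cong (scale-cong refl q≋q′) (∷-cong refl (⊛-congʳ p q≋q′))

⊛-congˡ : ∀ {p p′} q → p ≋ p′ → p ⊛ q ≋ p′ ⊛ q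
⊛-congˡ {[]}    {[]}     q p≋p′ = ≋-refl
⊛-congˡ {[]}    {b ∷ p′} q p≋p′ = ≋-sym (⊛-zeroˡ q (≋-sym p≋p′))
⊛-congˡ {a ∷ p} {[]}     q p≋p′ = ⊛-zeroˡ q p≋p′
⊛-congˡ {a ∷ p} {b ∷ p′} q p≋p′ =
  ⊕-cong (scale-cong (to≈ p≋p′ 0) ≋-refl) (∷-cong refl (⊛-congˡ q (tail-≋ p≋p′)))

⊛-cong : ∀ {p p′ q q′} → p ≋ p′ → q ≋ q′ → p ⊛ q ≋ p′ ⊛ q′
⊛-cong {p′ = p′} {q = q} p≋p′ q≋q′ = ≋-trans (⊛-congˡ q p≋p′) (⊛-congʳ p′ q≋q′)

cube-cong : ∀ {f f′} → f ≋ f′ → cube f ≋ cube f′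
cube-cong f≋f′ = ⊛-cong (⊛-cong f≋f′ f≋f′) f≋f′

∘-zeroˡ : ∀ {p} h → p ≋ [] → p ∘ₚ h ≋ []
∘-zeroˡ {[]}    h p≋[] = ≋-refl
∘-zeroˡ {a ∷ p} h p≋[] = ⊕-cong
  (∷-≋[] (to≈ p≋[] 0) ≋-refl)
  (≋-trans (⊛-congʳ h (∘-zeroˡ h (tail-≋[] p≋[]))) (⊛-zeroʳ h))

∘-congʳ : ∀ p {h h′} → h ≋ h′ → p ∘ₚ h ≋ p ∘ₚ h′
∘-congʳ []      h≋h′ = ≋-refl
∘-congʳ (a ∷ p) h≋h′ = ⊕-cong ≋-refl (⊛-cong h≋h′ (∘-congʳ p h≋h′))

∘-congˡ : ∀ {p p′} h → p ≋ p′ → p ∘ₚ h ≋ p′ ∘ₚ h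
∘-congˡ {[]}    {[]}     h p≋p′ = ≋-refl
∘-congˡ {[]}    {b ∷ p′} h p≋p′ = ≋-sym (∘-zeroˡ h (≋-sym p≋p′))
∘-congˡ {a ∷ p} {[]}     h p≋p′ = ∘-zeroˡ h p≋p′
∘-congˡ {a ∷ p} {b ∷ p′} h p≋p′ =
  ⊕-cong (∷-cong (to≈ p≋p′ 0) ≋-refl) (⊛-congʳ h (∘-congˡ h (tail-≋ p≋p′)))

∣ₚ-resp-≋ : ∀ {g g′ p p′} → g ≋ g′ → p ≋ p′ → g ∣ₚ p → g′ ∣ₚ p′
∣ₚ-resp-≋ g≋g′ p≋p′ (q , p≈gq) = q , to≈ (≋-trans (≋-sym p≋p′) (≋-trans (from≈ p≈gq) (⊛-congˡ q g≋g′)))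

IsSolution-resp-≋ : ∀ {f f′ g g′} → f ≋ f′ → g ≋ g′ → IsSolution f g → IsSolution f′ g′
IsSolution-resp-≋ f≋f′ g≋g′ (g∣f³+1 , f∣g³+1) =
  ∣ₚ-resp-≋ g≋g′ (⊕-cong (cube-cong f≋f′) ≋-refl) g∣f³+1 , ∣ₚ-resp-≋ f≋f′ (⊕-cong (cube-cong g≋g′) ≋-refl) f∣g³+1

IsTrivial-resp-≋ : ∀ {f f′ g g′} → f ≋ f′ → g ≋ g′ → IsTrivial f g → IsTrivial f′ g′
IsTrivial-resp-≋ f≋f′ g≋g′ (f₁ , g₁ , h , deg-h≥2 , f≈f₁∘h , g≈g₁∘h) =
  f₁ , g₁ , h , deg-h≥2 , to≈ (≋-trans (≋-sym f≋f′) (from≈ {q = f₁ ∘ₚ h} f≈f₁∘h)) ,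
  to≈ (≋-trans (≋-sym g≋g′) (from≈ {q = g₁ ∘ₚ h} g≈g₁∘h))

IsTrivial-swap : ∀ f g → IsTrivial f g → IsTrivial g f
IsTrivial-swap f g (f₁ , g₁ , h , deg-h≥2 , f≈f₁∘h , g≈g₁∘h) = g₁ , f₁ , h , deg-h≥2 , g≈g₁∘h , f≈f₁∘h

DegreeAtMost : Poly → ℕ → Set
DegreeAtMost p e = ∀ n → n ℕ.> e → coeff p n ≡ 0ℚ

monicQuadratic : ℚ → ℚ → Poly
monicQuadratic d₀ d₁ = d₀ ∷ d₁ ∷ 1ℚ ∷ []

≋-coeffs≤2 : ∀ p → DegreeAtMost p 2 → p ≋ coeff p 0 ∷ coeff p 1 ∷ coeff p 2 ∷ []
≋-coeffs≤2 p vanish = from≈ λ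
  { 0 → refl ; 1 → refl ; 2 → refl
  ; n@(suc (suc (suc _))) → vanish n (s≤s (s≤s (s≤s z≤n))) }

≋-coeffs≤1 : ∀ p → DegreeAtMost p 1 → p ≋ coeff p 0 ∷ coeff p 1 ∷ []
≋-coeffs≤1 p vanish = from≈ λ
  { 0 → refl ; 1 → refl
  ; n@(suc (suc _)) → vanish n (s≤s (s≤s z≤n)) }

degree2⇒scaled-monic : ∀ f → HasDegree f 2 →
  Σ ℚ λ k → Σ ℚ λ d₀ → Σ ℚ λ d₁ → k ≢ 0ℚ × f ≋ scale k (monicQuadratic d₀ d₁)
degree2⇒scaled-monic f (f₂≢0 , vanish) = f₂ , f₀ * 1/ f₂ , f₁ * 1/ f₂ , f₂≢0 ,
  ≋-trans (≋-coeffs≤2 f vanish)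
    (∷-cong (sym (*-cancel-inverse f₂ f₀)) (∷-cong (sym (*-cancel-inverse f₂ f₁))
      (∷-cong (sym (ℚ.*-identityʳ f₂)) ≋-refl)))
  where
  f₀ f₁ f₂ : ℚ
  f₀ = coeff f 0
  f₁ = coeff f 1
  f₂ = coeff f 2
  instance _ = ≢-nonZero f₂≢0

linear-∘-quadratic : ∀ a b h₀ h₁ h₂ →
  (a ∷ b ∷ []) ∘ₚ (h₀ ∷ h₁ ∷ h₂ ∷ []) ≋ a + b * h₀ ∷ b * h₁ ∷ b * h₂ ∷ []
linear-∘-quadratic a b h₀ h₁ h₂ = from≈ λ
  { 0 → solve 5 (λ a b h₀ h₁ h₂ → coeffₛ ((a ∷ b ∷ []) ∘ₛ (h₀ ∷ h₁ ∷ h₂ ∷ [])) 0 := a :+ b :* h₀) refl a b h₀ h₁ h₂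
  ; 1 → solve 5 (λ a b h₀ h₁ h₂ → coeffₛ ((a ∷ b ∷ []) ∘ₛ (h₀ ∷ h₁ ∷ h₂ ∷ [])) 1 := b :* h₁) refl a b h₀ h₁ h₂
  ; 2 → solve 5 (λ a b h₀ h₁ h₂ → coeffₛ ((a ∷ b ∷ []) ∘ₛ (h₀ ∷ h₁ ∷ h₂ ∷ [])) 2 := b :* h₂) refl a b h₀ h₁ h₂
  ; 3 → solve 5 (λ a b h₀ h₁ h₂ → coeffₛ ((a ∷ b ∷ []) ∘ₛ (h₀ ∷ h₁ ∷ h₂ ∷ [])) 3 := con 0ℚ) refl a b h₀ h₁ h₂
  ; 4 → solve 5 (λ a b h₀ h₁ h₂ → coeffₛ ((a ∷ b ∷ []) ∘ₛ (h₀ ∷ h₁ ∷ h₂ ∷ [])) 4 := con 0ℚ) refl a b h₀ h₁ h₂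
  ; (suc (suc (suc (suc (suc _))))) → refl
  }

F∘lin : ∀ α β → Fpoly ∘ₚ lin α β ≋ ½ * (β * β - β + 1ℚ) ∷ α * (β - ½) ∷ ½ * (α * α) ∷ []
F∘lin α β = from≈ λ
  { 0 → solve 2 (λ α β → coeffₛ (⌜ Fpoly ⌝ ∘ₛ (β ∷ α ∷ [])) 0 := con ½ :* (β :* β :- β :+ con 1ℚ)) refl α β
  ; 1 → solve 2 (λ α β → coeffₛ (⌜ Fpoly ⌝ ∘ₛ (β ∷ α ∷ [])) 1 := α :* (β :- con ½)) refl α β
  ; 2 → solve 2 (λ α β → coeffₛ (⌜ Fpoly ⌝ ∘ₛ (β ∷ α ∷ [])) 2 := con ½ :* (α :* α)) refl α β
  ; 3 → solve 2 (λ α β → coeffₛ (⌜ Fpoly ⌝ ∘ₛ (β ∷ α ∷ [])) 3 := con 0ℚ) refl α β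
  ; 4 → solve 2 (λ α β → coeffₛ (⌜ Fpoly ⌝ ∘ₛ (β ∷ α ∷ [])) 4 := con 0ℚ) refl α β
  ; (suc (suc (suc (suc (suc _))))) → refl
  }

G∘lin : ∀ α β → Gpoly ∘ₚ lin α β ≋ ½ * (β * β + β + 1ℚ) ∷ α * (β + ½) ∷ ½ * (α * α) ∷ []
G∘lin α β = from≈ λ
  { 0 → solve 2 (λ α β → coeffₛ (⌜ Gpoly ⌝ ∘ₛ (β ∷ α ∷ [])) 0 := con ½ :* (β :* β :+ β :+ con 1ℚ)) refl α β
  ; 1 → solve 2 (λ α β → coeffₛ (⌜ Gpoly ⌝ ∘ₛ (β ∷ α ∷ [])) 1 := α :* (β :+ con ½)) refl α β
  ; 2 → solve 2 (λ α β → coeffₛ (⌜ Gpoly ⌝ ∘ₛ (β ∷ α ∷ [])) 2 := con ½ :* (α :* α)) refl α β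
  ; 3 → solve 2 (λ α β → coeffₛ (⌜ Gpoly ⌝ ∘ₛ (β ∷ α ∷ [])) 3 := con 0ℚ) refl α β
  ; 4 → solve 2 (λ α β → coeffₛ (⌜ Gpoly ⌝ ∘ₛ (β ∷ α ∷ [])) 4 := con 0ℚ) refl α β
  ; (suc (suc (suc (suc (suc _))))) → refl
  }

-- K = ℚ[θ]/(θ² + c₁θ + c₀), with (x , y) standing for x + yθ; ev evaluates at θ by Horner's rule
module Quotient (c₀ c₁ : ℚ) where
  K : Set
  K = ℚ × ℚ

  infixl 6 _⊞_
  infixl 7 _⊠_ _·_
  infixr 5 _+θ·_

  _⊞_ : K → K → K
  (x , y) ⊞ (x′ , y′) = x + x′ , y + y′

  _⊠_ : K → K → K
  (x , y) ⊠ (x′ , y′) = x * x′ - c₀ * (y * y′) , x * y′ + y * x′ - c₁ * (y * y′)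

  _·_ : ℚ → K → K
  r · (x , y) = r * x , r * y

  0K 1K : K
  0K = 0ℚ , 0ℚ
  1K = 1ℚ , 0ℚ

  _+θ·_ : ℚ → K → K
  a +θ· (x , y) = a - c₀ * y , x - c₁ * y

  ev : Poly → K
  ev []      = 0K
  ev (a ∷ p) = a +θ· ev p

  trace : K → ℚ
  trace (x , y) = x + x - c₁ * y

  norm : K → ℚ
  norm (x , y) = x * x - c₁ * (x * y) + c₀ * (y * y)

  +θ·-⊞ : ∀ a b u v → (a + b) +θ· (u ⊞ v) ≡ (a +θ· u) ⊞ (b +θ· v)
  +θ·-⊞ a b (x , y) (x′ , y′) = cong₂ _,_
    (solve 5 (λ a b y y′ c₀ → (a :+ b) :- c₀ :* (y :+ y′) := (a :- c₀ :* y) :+ (b :- c₀ :* y′)) refl a b y y′ c₀)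
    (solve 5 (λ x x′ y y′ c₁ → (x :+ x′) :- c₁ :* (y :+ y′) := (x :- c₁ :* y) :+ (x′ :- c₁ :* y′)) refl x x′ y y′ c₁)

  +θ·-· : ∀ r a u → (r * a) +θ· (r · u) ≡ r · (a +θ· u)
  +θ·-· r a (x , y) = cong₂ _,_
    (solve 4 (λ r a y c₀ → r :* a :- c₀ :* (r :* y) := r :* (a :- c₀ :* y)) refl r a y c₀)
    (solve 4 (λ r x y c₁ → r :* x :- c₁ :* (r :* y) := r :* (x :- c₁ :* y)) refl r x y c₁)

  +θ·-⊠ : ∀ a u v → a · v ⊞ (0ℚ +θ· (u ⊠ v)) ≡ (a +θ· u) ⊠ v
  +θ·-⊠ a (x , y) (x′ , y′) = cong₂ _,_
    (solve 7 (λ a x y x′ y′ c₀ c₁ →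
      let Q = x :* y′ :+ y :* x′ :- c₁ :* (y :* y′); A = a :- c₀ :* y; B = x :- c₁ :* y in
      a :* x′ :+ (con 0ℚ :- c₀ :* Q) := A :* x′ :- c₀ :* (B :* y′)) refl a x y x′ y′ c₀ c₁)
    (solve 7 (λ a x y x′ y′ c₀ c₁ →
      let P = x :* x′ :- c₀ :* (y :* y′); Q = x :* y′ :+ y :* x′ :- c₁ :* (y :* y′)
          A = a :- c₀ :* y; B = x :- c₁ :* y in
      a :* y′ :+ (P :- c₁ :* Q) := A :* y′ :+ B :* x′ :- c₁ :* (B :* y′)) refl a x y x′ y′ c₀ c₁)

  ⊞-identityˡ : ∀ u → 0K ⊞ u ≡ u
  ⊞-identityˡ (x , y) = cong₂ _,_ (ℚ.+-identityˡ x) (ℚ.+-identityˡ y)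

  ⊞-identityʳ : ∀ u → u ⊞ 0K ≡ u
  ⊞-identityʳ (x , y) = cong₂ _,_ (ℚ.+-identityʳ x) (ℚ.+-identityʳ y)

  ⊠-zeroˡ : ∀ u → 0K ⊠ u ≡ 0K
  ⊠-zeroˡ (x , y) = cong₂ _,_
    (solve 3 (λ x y c₀ → con 0ℚ :* x :- c₀ :* (con 0ℚ :* y) := con 0ℚ) refl x y c₀)
    (solve 4 (λ x y c₀ c₁ → con 0ℚ :* y :+ con 0ℚ :* x :- c₁ :* (con 0ℚ :* y) := con 0ℚ) refl x y c₀ c₁)

  ·-zeroʳ : ∀ r → r · 0K ≡ 0K
  ·-zeroʳ r = cong₂ _,_ (ℚ.*-zeroʳ r) (ℚ.*-zeroʳ r)

  ev-⊕ : ∀ p q → ev (p ⊕ q) ≡ ev p ⊞ ev q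
  ev-⊕ []      q       = sym (⊞-identityˡ (ev q))
  ev-⊕ (a ∷ p) []      = sym (⊞-identityʳ (ev (a ∷ p)))
  ev-⊕ (a ∷ p) (b ∷ q) = trans (cong ((a + b) +θ·_) (ev-⊕ p q)) (+θ·-⊞ a b (ev p) (ev q))

  ev-scale : ∀ r p → ev (scale r p) ≡ r · ev p
  ev-scale r []      = sym (·-zeroʳ r)
  ev-scale r (a ∷ p) = trans (cong ((r * a) +θ·_) (ev-scale r p)) (+θ·-· r a (ev p))

  ev-⊛ : ∀ p q → ev (p ⊛ q) ≡ ev p ⊠ ev q
  ev-⊛ []      q = sym (⊠-zeroˡ (ev q))
  ev-⊛ (a ∷ p) q = begin
    ev (scale a q ⊕ (0ℚ ∷ p ⊛ q))         ≡⟨ ev-⊕ (scale a q) (0ℚ ∷ p ⊛ q) ⟩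
    ev (scale a q) ⊞ (0ℚ +θ· ev (p ⊛ q))  ≡⟨ cong₂ (λ v w → v ⊞ (0ℚ +θ· w)) (ev-scale a q) (ev-⊛ p q) ⟩
    a · ev q ⊞ (0ℚ +θ· (ev p ⊠ ev q))     ≡⟨ +θ·-⊠ a (ev p) (ev q) ⟩
    (a +θ· ev p) ⊠ ev q                   ∎

  0+θ·0 : 0ℚ +θ· 0K ≡ 0K
  0+θ·0 = cong₂ _,_
    (solve 1 (λ c₀ → con 0ℚ :- c₀ :* con 0ℚ := con 0ℚ) refl c₀)
    (solve 1 (λ c₁ → con 0ℚ :- c₁ :* con 0ℚ := con 0ℚ) refl c₁)

  ev-≋[] : ∀ {p} → p ≋ [] → ev p ≡ 0K
  ev-≋[] {[]}    p≋[] = refl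
  ev-≋[] {a ∷ p} p≋[] = trans (cong₂ _+θ·_ (to≈ p≋[] 0) (ev-≋[] (tail-≋[] p≋[]))) 0+θ·0

  ev-cong : ∀ {p q} → p ≋ q → ev p ≡ ev q
  ev-cong {[]}    {[]}    p≋q = refl
  ev-cong {[]}    {b ∷ q} p≋q = sym (ev-≋[] (≋-sym p≋q))
  ev-cong {a ∷ p} {[]}    p≋q = ev-≋[] p≋q
  ev-cong {a ∷ p} {b ∷ q} p≋q = cong₂ _+θ·_ (to≈ p≋q 0) (ev-cong (tail-≋ p≋q))

  ev-one : ev one ≡ 1K
  ev-one = cong₂ _,_
    (solve 1 (λ c₀ → con 1ℚ :- c₀ :* con 0ℚ := con 1ℚ) refl c₀)
    (solve 1 (λ c₁ → con 0ℚ :- c₁ :* con 0ℚ := con 0ℚ) refl c₁)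

  ev-quadratic : ∀ a₀ a₁ a₂ → ev (a₀ ∷ a₁ ∷ a₂ ∷ []) ≡ (a₀ - c₀ * a₂ , a₁ - c₁ * a₂)
  ev-quadratic a₀ a₁ a₂ = cong₂ _,_
    (solve 5 (λ a₀ a₁ a₂ c₀ c₁ →
      let q = con 0ℚ :- c₁ :* con 0ℚ; q′ = (a₂ :- c₀ :* con 0ℚ) :- c₁ :* q in
      a₀ :- c₀ :* q′ := a₀ :- c₀ :* a₂) refl a₀ a₁ a₂ c₀ c₁)
    (solve 5 (λ a₀ a₁ a₂ c₀ c₁ →
      let q = con 0ℚ :- c₁ :* con 0ℚ; q′ = (a₂ :- c₀ :* con 0ℚ) :- c₁ :* q in
      (a₁ :- c₀ :* q) :- c₁ :* q′ := a₁ :- c₁ :* a₂) refl a₀ a₁ a₂ c₀ c₁)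

  ev-multiple : ∀ g p → g ∣ₚ p → ev g ≡ 0K → ev p ≡ 0K
  ev-multiple g p (q , p≈gq) ev-g≡0 = begin
    ev p         ≡⟨ ev-cong (from≈ p≈gq) ⟩
    ev (g ⊛ q)   ≡⟨ ev-⊛ g q ⟩
    ev g ⊠ ev q  ≡⟨ cong (_⊠ ev q) ev-g≡0 ⟩
    0K ⊠ ev q    ≡⟨ ⊠-zeroˡ (ev q) ⟩
    0K           ∎

  cube+1 : ∀ u → let δ = trace u * trace u - norm u in
    u ⊠ u ⊠ u ⊞ 1K ≡ (δ * proj₁ u + (1ℚ - trace u * norm u) , δ * proj₂ u)
  cube+1 (x , y) = cong₂ _,_
    (solve 4 (λ x y c₀ c₁ →
      let P = x :* x :- c₀ :* (y :* y); Q = x :* y :+ y :* x :- c₁ :* (y :* y)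
          T = traceₛ c₁ (x , y); N = normₛ c₀ c₁ (x , y) in
      (P :* x :- c₀ :* (Q :* y)) :+ con 1ℚ := (T :* T :- N) :* x :+ (con 1ℚ :- T :* N)) refl x y c₀ c₁)
    (solve 4 (λ x y c₀ c₁ →
      let P = x :* x :- c₀ :* (y :* y); Q = x :* y :+ y :* x :- c₁ :* (y :* y)
          T = traceₛ c₁ (x , y); N = normₛ c₀ c₁ (x , y) in
      (P :* y :+ Q :* x :- c₁ :* (Q :* y)) :+ con 0ℚ := (T :* T :- N) :* y) refl x y c₀ c₁)

  -- u ∉ ℚ with minimal polynomial t² − t + 1
  IsPrimitiveSixthRoot : K → Set
  IsPrimitiveSixthRoot u = proj₂ u ≢ 0ℚ × trace u ≡ 1ℚ × norm u ≡ 1ℚ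

  cube-roots-of-−1 : ∀ u → u ⊠ u ⊠ u ⊞ 1K ≡ 0K → u ≡ (- 1ℚ , 0ℚ) ⊎ IsPrimitiveSixthRoot u
  cube-roots-of-−1 (x , y) u³+1≡0 with y ℚ.≟ 0ℚ
  ... | yes refl = inj₁ (cong (_, 0ℚ) (x³+1≡0⇒x≡-1 x x³+1≡0))
    where
    x³+1≡0 : x * x * x + 1ℚ ≡ 0ℚ
    x³+1≡0 = begin
      x * x * x + 1ℚ
        ≡⟨ solve 3 (λ x c₀ c₁ → let T = traceₛ c₁ (x , con 0ℚ); N = normₛ c₀ c₁ (x , con 0ℚ) in
             x :* x :* x :+ con 1ℚ := (T :* T :- N) :* x :+ (con 1ℚ :- T :* N)) refl x c₀ c₁ ⟩
      (trace u * trace u - norm u) * x + (1ℚ - trace u * norm u)  ≡⟨ cong proj₁ (cube+1 u) ⟨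
      proj₁ (u ⊠ u ⊠ u ⊞ 1K)                                      ≡⟨ cong proj₁ u³+1≡0 ⟩
      0ℚ                                                          ∎
      where
      u : K
      u = x , 0ℚ
  ... | no y≢0 = inj₂ (y≢0 , T≡1 , N≡1)
    where
    T N δ : ℚ
    T = trace (x , y)
    N = norm (x , y)
    δ = T * T - N
    components : (δ * x + (1ℚ - T * N) , δ * y) ≡ (0ℚ , 0ℚ)
    components = trans (sym (cube+1 (x , y))) u³+1≡0
    δ≡0 : δ ≡ 0ℚ
    δ≡0 = [ (λ δ≡0 → δ≡0) , (λ y≡0 → ⊥-elim (y≢0 y≡0)) ]′ (x*y≡0⇒x≡0∨y≡0 δ y (cong proj₂ components))
    TN≡1 : T * N ≡ 1ℚ
    TN≡1 = sym (x-y≡0⇒x≡y 1ℚ (T * N) (begin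
      1ℚ - T * N             ≡⟨ solve 3 (λ x T N → con 1ℚ :- T :* N := con 0ℚ :* x :+ (con 1ℚ :- T :* N)) refl x T N ⟩
      0ℚ * x + (1ℚ - T * N)  ≡⟨ cong (λ d → d * x + (1ℚ - T * N)) δ≡0 ⟨
      δ * x + (1ℚ - T * N)   ≡⟨ cong proj₁ components ⟩
      0ℚ                     ∎))
    T≡1 : T ≡ 1ℚ
    T≡1 = x³≡1⇒x≡1 T (begin
      T * T * T           ≡⟨ solve 2 (λ T N → T :* T :* T := T :* (T :* T :- N) :+ T :* N) refl T N ⟩
      T * δ + T * N       ≡⟨ cong₂ (λ d e → T * d + e) δ≡0 TN≡1 ⟩
      T * 0ℚ + 1ℚ         ≡⟨ cong (_+ 1ℚ) (ℚ.*-zeroʳ T) ⟩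
      1ℚ                  ∎)
    N≡1 : N ≡ 1ℚ
    N≡1 = begin
      N          ≡⟨ solve 2 (λ T N → N := T :* T :- (T :* T :- N)) refl T N ⟩
      T * T - δ  ≡⟨ cong₂ (λ t d → t * t - d) T≡1 δ≡0 ⟩
      1ℚ         ∎

  ev-scaled-monic : ∀ k d₀ d₁ → ev (scale k (monicQuadratic d₀ d₁)) ≡ (k * (d₀ - c₀) , k * (d₁ - c₁))
  ev-scaled-monic k d₀ d₁ = trans (ev-quadratic (k * d₀) (k * d₁) (k * 1ℚ)) (cong₂ _,_
    (solve 4 (λ k d₀ c₀ c₁ → k :* d₀ :- c₀ :* (k :* con 1ℚ) := k :* (d₀ :- c₀)) refl k d₀ c₀ c₁)
    (solve 4 (λ k d₁ c₀ c₁ → k :* d₁ :- c₁ :* (k :* con 1ℚ) := k :* (d₁ :- c₁)) refl k d₁ c₀ c₁))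

  ev-scaled-monic-self : ∀ k → ev (scale k (monicQuadratic c₀ c₁)) ≡ 0K
  ev-scaled-monic-self k = trans (ev-scaled-monic k c₀ c₁) (cong₂ _,_
    (solve 2 (λ k c₀ → k :* (c₀ :- c₀) := con 0ℚ) refl k c₀)
    (solve 2 (λ k c₁ → k :* (c₁ :- c₁) := con 0ℚ) refl k c₁))

  ev-cube+1 : ∀ f → ev (cube f ⊕ one) ≡ ev f ⊠ ev f ⊠ ev f ⊞ 1K
  ev-cube+1 f = begin
    ev (cube f ⊕ one)              ≡⟨ ev-⊕ (cube f) one ⟩
    ev (f ⊛ f ⊛ f) ⊞ ev one        ≡⟨ cong₂ _⊞_ (trans (ev-⊛ (f ⊛ f) f) (cong (_⊠ ev f) (ev-⊛ f f))) ev-one ⟩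
    ev f ⊠ ev f ⊠ ev f ⊞ 1K        ∎

nontrivial⇒primitive-sixth-root : ∀ k₁ d₀ d₁ k₂ c₀ c₁ →
  let f = scale k₁ (monicQuadratic d₀ d₁); g = scale k₂ (monicQuadratic c₀ c₁) in
  g ∣ₚ cube f ⊕ one → ¬ IsTrivial f g →
  Quotient.IsPrimitiveSixthRoot c₀ c₁ (k₁ * (d₀ - c₀) , k₁ * (d₁ - c₁))
nontrivial⇒primitive-sixth-root k₁ d₀ d₁ k₂ c₀ c₁ g∣f³+1 nontrivial =
  [ (λ u≡-1 → ⊥-elim (nontrivial (trivial u≡-1))) , (λ root → root) ]′ (cube-roots-of-−1 u u³+1≡0)
  where
  open Quotient c₀ c₁
  f g : Poly
  f = scale k₁ (monicQuadratic d₀ d₁)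
  g = scale k₂ (monicQuadratic c₀ c₁)
  u : K
  u = k₁ * (d₀ - c₀) , k₁ * (d₁ - c₁)

  u³+1≡0 : u ⊠ u ⊠ u ⊞ 1K ≡ 0K
  u³+1≡0 = begin
    u ⊠ u ⊠ u ⊞ 1K            ≡⟨ cong (λ v → v ⊠ v ⊠ v ⊞ 1K) (ev-scaled-monic k₁ d₀ d₁) ⟨
    ev f ⊠ ev f ⊠ ev f ⊞ 1K   ≡⟨ ev-cube+1 f ⟨
    ev (cube f ⊕ one)         ≡⟨ ev-multiple g (cube f ⊕ one) g∣f³+1 (ev-scaled-monic-self k₂) ⟩
    0K                        ∎

  -- f = −1 + k₁ h and g = k₂ h for the monic h = t² + c₁ t + c₀
  trivial : u ≡ (- 1ℚ , 0ℚ) → IsTrivial f g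
  trivial u≡-1 = - 1ℚ ∷ k₁ ∷ [] , 0ℚ ∷ k₂ ∷ [] , monicQuadratic c₀ c₁ , (2 , s≤s (s≤s z≤n) , ℚ.1≢0) ,
    to≈ (≋-trans (∷-cong f₀≡ (∷-cong f₁≡ ≋-refl)) (≋-sym (linear-∘-quadratic (- 1ℚ) k₁ c₀ c₁ 1ℚ))) ,
    to≈ (≋-trans (∷-cong (sym (ℚ.+-identityˡ (k₂ * c₀))) ≋-refl) (≋-sym (linear-∘-quadratic 0ℚ k₂ c₀ c₁ 1ℚ)))
    where
    f₀≡ : k₁ * d₀ ≡ - 1ℚ + k₁ * c₀
    f₀≡ = lincomb₁ (cong proj₁ u≡-1) 1ℚ
      (solve 3 (λ k₁ d₀ c₀ → k₁ :* d₀ :- (:- con 1ℚ :+ k₁ :* c₀) := con 1ℚ :* (k₁ :* (d₀ :- c₀) :- :- con 1ℚ)) refl k₁ d₀ c₀)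
    f₁≡ : k₁ * d₁ ≡ k₁ * c₁
    f₁≡ = lincomb₁ (cong proj₂ u≡-1) 1ℚ
      (solve 3 (λ k₁ d₁ c₁ → k₁ :* d₁ :- k₁ :* c₁ := con 1ℚ :* (k₁ :* (d₁ :- c₁) :- con 0ℚ)) refl k₁ d₁ c₁)

module MutualSixthRoots (k₁ k₂ d₀ d₁ c₀ c₁ : ℚ) (k₁≢0 : k₁ ≢ 0ℚ) (k₂≢0 : k₂ ≢ 0ℚ)
  (root₁ : Quotient.IsPrimitiveSixthRoot c₀ c₁ (k₁ * (d₀ - c₀) , k₁ * (d₁ - c₁)))
  (root₂ : Quotient.IsPrimitiveSixthRoot d₀ d₁ (k₂ * (c₀ - d₀) , k₂ * (c₁ - d₁))) where

  a b α β : ℚ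
  a = d₀ - c₀
  b = d₁ - c₁
  α = - (k₁ * b)
  β = - (k₁ * a)

  open Quotient using (trace; norm)

  private
    T₁ : trace c₀ c₁ (k₁ * a , k₁ * b) ≡ 1ℚ
    T₁ = proj₁ (proj₂ root₁)
    N₁ : norm c₀ c₁ (k₁ * a , k₁ * b) ≡ 1ℚ
    N₁ = proj₂ (proj₂ root₁)
    T₂ : trace d₀ d₁ (k₂ * (c₀ - d₀) , k₂ * (c₁ - d₁)) ≡ 1ℚ
    T₂ = proj₁ (proj₂ root₂)
    N₂ : norm d₀ d₁ (k₂ * (c₀ - d₀) , k₂ * (c₁ - d₁)) ≡ 1ℚ
    N₂ = proj₂ (proj₂ root₂)

  k₁b≢0 : k₁ * b ≢ 0ℚ
  k₁b≢0 = proj₁ root₁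

  b≢0 : b ≢ 0ℚ
  b≢0 b≡0 = k₁b≢0 (trans (cong (k₁ *_) b≡0) (ℚ.*-zeroʳ k₁))

  α≢0 : α ≢ 0ℚ
  α≢0 α≡0 = k₁b≢0 (ℚ.neg-injective α≡0)

  -- both norms are n = a² − c₁ab + c₀b², scaled by k₁² and k₂² respectively
  k₁²≡k₂² : k₁ * k₁ ≡ k₂ * k₂
  k₁²≡k₂² = lincomb₂ N₂ N₁ (- (k₁ * k₁)) (k₂ * k₂)
    (solve 6 (λ k₁ k₂ d₀ d₁ c₀ c₁ →
      k₁ :* k₁ :- k₂ :* k₂
        := (:- (k₁ :* k₁)) :* (normₛ d₀ d₁ (k₂ :* (c₀ :- d₀) , k₂ :* (c₁ :- d₁)) :- con 1ℚ)
           :+ (k₂ :* k₂) :* (normₛ c₀ c₁ (k₁ :* (d₀ :- c₀) , k₁ :* (d₁ :- c₁)) :- con 1ℚ))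
      refl k₁ k₂ d₀ d₁ c₀ c₁)

  -- k₂ T₁ + k₁ T₂ = k₁ k₂ b², since the two traces are k₁ (2a − c₁b) and k₂ (d₁b − 2a)
  k₁k₂b²≡k₁+k₂ : k₁ * k₂ * (b * b) ≡ k₁ + k₂
  k₁k₂b²≡k₁+k₂ = lincomb₂ T₁ T₂ k₂ k₁
    (solve 6 (λ k₁ k₂ d₀ d₁ c₀ c₁ →
      k₁ :* k₂ :* ((d₁ :- c₁) :* (d₁ :- c₁)) :- (k₁ :+ k₂)
        := k₂ :* (traceₛ c₁ (k₁ :* (d₀ :- c₀) , k₁ :* (d₁ :- c₁)) :- con 1ℚ)
           :+ k₁ :* (traceₛ d₁ (k₂ :* (c₀ :- d₀) , k₂ :* (c₁ :- d₁)) :- con 1ℚ))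
      refl k₁ k₂ d₀ d₁ c₀ c₁)

  k₁≡k₂ : k₁ ≡ k₂
  k₁≡k₂ = [ x-y≡0⇒x≡y k₁ k₂ , (λ k₁+k₂≡0 → ⊥-elim (k₁k₂b²≢0 (trans k₁k₂b²≡k₁+k₂ k₁+k₂≡0))) ]′
    (x*y≡0⇒x≡0∨y≡0 (k₁ - k₂) (k₁ + k₂) (lincomb₁ k₁²≡k₂² 1ℚ
      (solve 2 (λ k₁ k₂ → (k₁ :- k₂) :* (k₁ :+ k₂) :- con 0ℚ := con 1ℚ :* (k₁ :* k₁ :- k₂ :* k₂)) refl k₁ k₂)))
    where
    k₁k₂b²≢0 : k₁ * k₂ * (b * b) ≢ 0ℚ
    k₁k₂b²≢0 = x≢0∧y≢0⇒x*y≢0 (x≢0∧y≢0⇒x*y≢0 k₁≢0 k₂≢0) (x≢0∧y≢0⇒x*y≢0 b≢0 b≢0)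

  k₁b²≡2 : k₁ * (b * b) ≡ 1ℚ + 1ℚ
  k₁b²≡2 = *-cancelˡ-≡ k₁ k₁≢0 (lincomb₂ k₁k₂b²≡k₁+k₂ (sym k₁≡k₂) 1ℚ (1ℚ - k₁ * (b * b))
    (solve 3 (λ k₁ k₂ b →
      k₁ :* (k₁ :* (b :* b)) :- k₁ :* (con 1ℚ :+ con 1ℚ)
        := con 1ℚ :* (k₁ :* k₂ :* (b :* b) :- (k₁ :+ k₂)) :+ (con 1ℚ :- k₁ :* (b :* b)) :* (k₂ :- k₁))
      refl k₁ k₂ b))

  f₂≡ : k₁ * 1ℚ ≡ ½ * (α * α)
  f₂≡ = lincomb₁ k₁b²≡2 (- (½ * k₁))
    (solve 2 (λ k₁ b → k₁ :* con 1ℚ :- con ½ :* ((:- (k₁ :* b)) :* (:- (k₁ :* b)))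
      := (:- (con ½ :* k₁)) :* (k₁ :* (b :* b) :- (con 1ℚ :+ con 1ℚ))) refl k₁ b)

  f₁≡ : k₁ * d₁ ≡ α * (β - ½)
  f₁≡ = *-cancelˡ-≡ b b≢0 (lincomb₂ T₁ k₁b²≡2 (- 1ℚ) (½ - k₁ * a)
    (solve 5 (λ k₁ d₀ d₁ c₀ c₁ →
      let a = d₀ :- c₀; b = d₁ :- c₁; α = :- (k₁ :* b); β = :- (k₁ :* a) in
      b :* (k₁ :* d₁) :- b :* (α :* (β :- con ½))
        := (:- con 1ℚ) :* (traceₛ c₁ (k₁ :* a , k₁ :* b) :- con 1ℚ)
           :+ (con ½ :- k₁ :* a) :* (k₁ :* (b :* b) :- (con 1ℚ :+ con 1ℚ)))
      refl k₁ d₀ d₁ c₀ c₁))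

  f₀≡ : k₁ * d₀ ≡ ½ * (β * β - β + 1ℚ)
  f₀≡ = lincomb₃ N₁ T₁ k₁b²≡2 ½ (- (½ * (k₁ * a))) (½ * (k₁ * a - k₁ * d₀))
    (solve 5 (λ k₁ d₀ d₁ c₀ c₁ →
      let a = d₀ :- c₀; b = d₁ :- c₁; β = :- (k₁ :* a) in
      k₁ :* d₀ :- con ½ :* (β :* β :- β :+ con 1ℚ)
        := con ½ :* (normₛ c₀ c₁ (k₁ :* a , k₁ :* b) :- con 1ℚ)
           :+ (:- (con ½ :* (k₁ :* a))) :* (traceₛ c₁ (k₁ :* a , k₁ :* b) :- con 1ℚ)
           :+ con ½ :* (k₁ :* a :- k₁ :* d₀) :* (k₁ :* (b :* b) :- (con 1ℚ :+ con 1ℚ)))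
      refl k₁ d₀ d₁ c₀ c₁)

  g₁≡ : k₁ * c₁ ≡ α * (β + ½)
  g₁≡ = lincomb₁ f₁≡ 1ℚ
    (solve 5 (λ k₁ d₀ d₁ c₀ c₁ → let α = :- (k₁ :* (d₁ :- c₁)); β = :- (k₁ :* (d₀ :- c₀)) in
      k₁ :* c₁ :- α :* (β :+ con ½) := con 1ℚ :* (k₁ :* d₁ :- α :* (β :- con ½)))
      refl k₁ d₀ d₁ c₀ c₁)

  g₀≡ : k₁ * c₀ ≡ ½ * (β * β + β + 1ℚ)
  g₀≡ = lincomb₁ f₀≡ 1ℚ
    (solve 3 (λ k₁ d₀ c₀ → let β = :- (k₁ :* (d₀ :- c₀)) in
      k₁ :* c₀ :- con ½ :* (β :* β :+ β :+ con 1ℚ) := con 1ℚ :* (k₁ :* d₀ :- con ½ :* (β :* β :- β :+ con 1ℚ)))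
      refl k₁ d₀ c₀)

  f≋F∘lin : scale k₁ (monicQuadratic d₀ d₁) ≋ Fpoly ∘ₚ lin α β
  f≋F∘lin = ≋-trans (∷-cong f₀≡ (∷-cong f₁≡ (∷-cong f₂≡ ≋-refl))) (≋-sym (F∘lin α β))

  g≋G∘lin : scale k₂ (monicQuadratic c₀ c₁) ≋ Gpoly ∘ₚ lin α β
  g≋G∘lin = ≋-trans (scale-cong (sym k₁≡k₂) ≋-refl)
    (≋-trans (∷-cong g₀≡ (∷-cong g₁≡ (∷-cong f₂≡ ≋-refl))) (≋-sym (G∘lin α β)))

scaled-monic-solution-form : ∀ k₁ d₀ d₁ k₂ c₀ c₁ → k₁ ≢ 0ℚ → k₂ ≢ 0ℚ →
  let f = scale k₁ (monicQuadratic d₀ d₁); g = scale k₂ (monicQuadratic c₀ c₁) in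
  IsSolution f g → ¬ IsTrivial f g →
  Σ ℚ λ α → Σ ℚ λ β → α ≢ 0ℚ × f ≋ Fpoly ∘ₚ lin α β × g ≋ Gpoly ∘ₚ lin α β
scaled-monic-solution-form k₁ d₀ d₁ k₂ c₀ c₁ k₁≢0 k₂≢0 (g∣f³+1 , f∣g³+1) nontrivial =
  α , β , α≢0 , f≋F∘lin , g≋G∘lin
  where
  f g : Poly
  f = scale k₁ (monicQuadratic d₀ d₁)
  g = scale k₂ (monicQuadratic c₀ c₁)
  open MutualSixthRoots k₁ k₂ d₀ d₁ c₀ c₁ k₁≢0 k₂≢0
    (nontrivial⇒primitive-sixth-root k₁ d₀ d₁ k₂ c₀ c₁ g∣f³+1 nontrivial)
    (nontrivial⇒primitive-sixth-root k₂ c₀ c₁ k₁ d₀ d₁ f∣g³+1 (nontrivial ∘ IsTrivial-swap g f))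

nontrivial-solution-form : ∀ f g → HasDegree f 2 → HasDegree g 2 → IsSolution f g → ¬ IsTrivial f g →
  Σ ℚ λ α → Σ ℚ λ β → α ≢ 0ℚ × (f ≈ Fpoly ∘ₚ lin α β) × (g ≈ Gpoly ∘ₚ lin α β)
nontrivial-solution-form f g f-deg g-deg solution nontrivial =
  let (k₁ , d₀ , d₁ , k₁≢0 , f≋) = degree2⇒scaled-monic f f-deg
      (k₂ , c₀ , c₁ , k₂≢0 , g≋) = degree2⇒scaled-monic g g-deg
      (α , β , α≢0 , f′≋ , g′≋) = scaled-monic-solution-form k₁ d₀ d₁ k₂ c₀ c₁ k₁≢0 k₂≢0
        (IsSolution-resp-≋ f≋ g≋ solution) (nontrivial ∘ IsTrivial-resp-≋ (≋-sym f≋) (≋-sym g≋))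
  in α , β , α≢0 , to≈ (≋-trans f≋ f′≋) , to≈ (≋-trans g≋ g′≋)

HasDegree-resp-≋ : ∀ {p q d} → p ≋ q → HasDegree p d → HasDegree q d
HasDegree-resp-≋ {d = d} (from≈ p≈q) (pᵈ≢0 , vanish) =
  (λ qᵈ≡0 → pᵈ≢0 (trans (p≈q d) qᵈ≡0)) , (λ n d<n → trans (sym (p≈q n)) (vanish n d<n))

HasDegree-unique : ∀ p {d e} → HasDegree p d → HasDegree p e → d ≡ e
HasDegree-unique p {d} {e} (pᵈ≢0 , vanishᵈ) (pᵉ≢0 , vanishᵉ) with ℕ.<-cmp d e
... | tri< d<e _ _ = ⊥-elim (pᵉ≢0 (vanishᵈ e d<e))
... | tri≈ _ d≡e _ = d≡e
... | tri> _ _ e<d = ⊥-elim (pᵈ≢0 (vanishᵉ d e<d))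

≤-degree : ∀ p {n e} → coeff p n ≢ 0ℚ → HasDegree p e → n ≤ e
≤-degree p {n} {e} pⁿ≢0 (_ , vanish) with n ℕ.≤? e
... | yes n≤e = n≤e
... | no n≰e = ⊥-elim (pⁿ≢0 (vanish n (ℕ.≰⇒> n≰e)))

degree-exists : ∀ p → p ≋ [] ⊎ Σ ℕ (HasDegree p)
degree-exists [] = inj₁ ≋-refl
degree-exists (a ∷ p) with degree-exists p
... | inj₂ (e , pᵉ≢0 , vanish) = inj₂ (suc e , pᵉ≢0 , λ { (suc n) (s≤s e<n) → vanish n e<n })
... | inj₁ p≋[] with a ℚ.≟ 0ℚ
...   | yes a≡0 = inj₁ (∷-≋[] a≡0 p≋[])
...   | no a≢0  = inj₂ (0 , a≢0 , λ { (suc n) _ → to≈ p≋[] n })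

DegreeAtMost0⇒tail≋[] : ∀ {a p} → DegreeAtMost (a ∷ p) 0 → p ≋ []
DegreeAtMost0⇒tail≋[] vanish = from≈ λ n → vanish (suc n) (s≤s z≤n)

HasDegree-∷0 : ∀ {a p} → a ≢ 0ℚ → p ≋ [] → HasDegree (a ∷ p) 0
HasDegree-∷0 a≢0 p≋[] = a≢0 , λ { (suc n) _ → to≈ p≋[] n }

HasDegree-tail : ∀ a p {d} → HasDegree (a ∷ p) (suc d) → HasDegree p d
HasDegree-tail a p (pᵈ≢0 , vanish) = pᵈ≢0 , λ n d<n → vanish (suc n) (s≤s d<n)

HasDegree-0∷ : ∀ p {d} → HasDegree p d → HasDegree (0ℚ ∷ p) (suc d)
HasDegree-0∷ p (pᵈ≢0 , vanish) = pᵈ≢0 , λ { (suc n) (s≤s d<n) → vanish n d<n }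

scale-DegreeAtMost : ∀ c p {e} → DegreeAtMost p e → DegreeAtMost (scale c p) e
scale-DegreeAtMost c p vanish n e<n = trans (coeff-scale c p n) (trans (cong (c *_) (vanish n e<n)) (ℚ.*-zeroʳ c))

HasDegree-scale : ∀ c p {d} → c ≢ 0ℚ → HasDegree p d → HasDegree (scale c p) d
HasDegree-scale c p {d} c≢0 (pᵈ≢0 , vanish) =
  (λ cpᵈ≡0 → x≢0∧y≢0⇒x*y≢0 c≢0 pᵈ≢0 (trans (sym (coeff-scale c p d)) cpᵈ≡0)) , scale-DegreeAtMost c p vanish

HasDegree-⊕-lower : ∀ p q {e d} → DegreeAtMost p e → e < d → HasDegree q d → HasDegree (p ⊕ q) d
HasDegree-⊕-lower p q {e} {d} p-vanish e<d (qᵈ≢0 , q-vanish) =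
  (λ sumᵈ≡0 → qᵈ≢0 (begin
    coeff q d              ≡⟨ ℚ.+-identityˡ (coeff q d) ⟨
    0ℚ + coeff q d         ≡⟨ cong (_+ coeff q d) (p-vanish d e<d) ⟨
    coeff p d + coeff q d  ≡⟨ coeff-⊕ p q d ⟨
    coeff (p ⊕ q) d        ≡⟨ sumᵈ≡0 ⟩
    0ℚ                     ∎)) ,
  (λ n d<n → trans (coeff-⊕ p q n) (cong₂ _+_ (p-vanish n (ℕ.<-trans e<d d<n)) (q-vanish n d<n)))

HasDegree-⊛ : ∀ p q {d e} → HasDegree p d → HasDegree q e → HasDegree (p ⊛ q) (d ℕ.+ e)
HasDegree-⊛ []      q (pᵈ≢0 , _) _ = ⊥-elim (pᵈ≢0 refl)
HasDegree-⊛ (a ∷ p) q {zero} (a≢0 , vanish) q-deg =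
  HasDegree-resp-≋ (≋-sym (≋-trans (⊕-cong ≋-refl (∷-≋[] refl (⊛-zeroˡ q (DegreeAtMost0⇒tail≋[] vanish))))
    (⊕-identityʳ (scale a q)))) (HasDegree-scale a q a≢0 q-deg)
HasDegree-⊛ (a ∷ p) q {suc d} {e} p-deg q-deg =
  HasDegree-⊕-lower (scale a q) (0ℚ ∷ p ⊛ q) (scale-DegreeAtMost a q (proj₂ q-deg)) (s≤s (ℕ.m≤n+m e d))
    (HasDegree-0∷ (p ⊛ q) (HasDegree-⊛ p q (HasDegree-tail a p p-deg) q-deg))

HasDegree-∘ : ∀ p h {d e} → HasDegree p d → HasDegree h (suc e) → HasDegree (p ∘ₚ h) (d ℕ.* suc e)
HasDegree-∘ []      h (pᵈ≢0 , _) _ = ⊥-elim (pᵈ≢0 refl)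
HasDegree-∘ (a ∷ p) h {zero} (a≢0 , vanish) h-deg = HasDegree-resp-≋ (≋-sym composite≋a) (HasDegree-∷0 a≢0 ≋-refl)
  where
  composite≋a : (a ∷ p) ∘ₚ h ≋ a ∷ []
  composite≋a = ⊕-cong ≋-refl (≋-trans (⊛-congʳ h (∘-zeroˡ h (DegreeAtMost0⇒tail≋[] {a} vanish))) (⊛-zeroʳ h))
HasDegree-∘ (a ∷ p) h {suc d} p-deg h-deg =
  HasDegree-⊕-lower (a ∷ []) (h ⊛ (p ∘ₚ h)) (λ { (suc n) _ → refl }) (s≤s z≤n)
    (HasDegree-⊛ h (p ∘ₚ h) h-deg (HasDegree-∘ p h (HasDegree-tail a p p-deg) h-deg))

m*n≡2⇒m≡1∧n≡2 : ∀ m n → 2 ≤ n → m ℕ.* n ≡ 2 → m ≡ 1 × n ≡ 2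
m*n≡2⇒m≡1∧n≡2 zero          n             _ ()
m*n≡2⇒m≡1∧n≡2 (suc zero)    n             _ m*n≡2 = refl , trans (sym (ℕ.+-identityʳ n)) m*n≡2
m*n≡2⇒m≡1∧n≡2 (suc (suc m)) (suc zero)    (s≤s ()) _
m*n≡2⇒m≡1∧n≡2 (suc (suc m)) (suc (suc n)) _ m*n≡2 =
  ⊥-elim (ℕ.m+1+n≢0 n (ℕ.suc-injective (ℕ.suc-injective m*n≡2)))

composite-of-degree-2 : ∀ f₁ h {e} → HasDegree (f₁ ∘ₚ h) 2 → HasDegree h e → 2 ≤ e → HasDegree f₁ 1 × e ≡ 2
composite-of-degree-2 f₁ h f₁∘h-deg h-deg 2≤e with degree-exists f₁
... | inj₁ f₁≋[] = ⊥-elim (proj₁ f₁∘h-deg (to≈ (∘-zeroˡ h f₁≋[]) 2))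
composite-of-degree-2 f₁ h {suc e} f₁∘h-deg h-deg 2≤e | inj₂ (d , f₁-deg)
  with m*n≡2⇒m≡1∧n≡2 d (suc e) 2≤e (HasDegree-unique (f₁ ∘ₚ h) (HasDegree-∘ f₁ h f₁-deg h-deg) f₁∘h-deg)
... | refl , e+1≡2 = f₁-deg , e+1≡2

HasDegree-quadratic : ∀ {c₀ c₁ c₂} → c₂ ≢ 0ℚ → HasDegree (c₀ ∷ c₁ ∷ c₂ ∷ []) 2
HasDegree-quadratic c₂≢0 = c₂≢0 , λ
  { 0 () ; 1 (s≤s ()) ; 2 (s≤s (s≤s ())) ; (suc (suc (suc n))) _ → refl }

linear∘quadratic-coeffs : ∀ f₁ h → HasDegree f₁ 1 → HasDegree h 2 →
  f₁ ∘ₚ h ≋ coeff f₁ 0 + coeff f₁ 1 * coeff h 0 ∷ coeff f₁ 1 * coeff h 1 ∷ coeff f₁ 1 * coeff h 2 ∷ []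
linear∘quadratic-coeffs f₁ h f₁-deg h-deg =
  ≋-trans (∘-congˡ h (≋-coeffs≤1 f₁ (proj₂ f₁-deg)))
    (≋-trans (∘-congʳ (coeff f₁ 0 ∷ coeff f₁ 1 ∷ []) (≋-coeffs≤2 h (proj₂ h-deg)))
      (linear-∘-quadratic (coeff f₁ 0) (coeff f₁ 1) (coeff h 0) (coeff h 1) (coeff h 2)))

linear∘quadratic-degrees : ∀ p f₁ h → HasDegree p 2 → p ≋ f₁ ∘ₚ h → DegreeAtLeast2 h → HasDegree f₁ 1 × HasDegree h 2
linear∘quadratic-degrees p f₁ h p-deg p≋f₁∘h (n , 2≤n , hⁿ≢0) with degree-exists h
... | inj₁ h≋[] = ⊥-elim (hⁿ≢0 (to≈ h≋[] n))
... | inj₂ (e , h-deg)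
  with composite-of-degree-2 f₁ h (HasDegree-resp-≋ p≋f₁∘h p-deg) h-deg (ℕ.≤-trans 2≤n (≤-degree h hⁿ≢0 h-deg))
...  | f₁-deg , refl = f₁-deg , h-deg

F∘lin-G∘lin-nontrivial : ∀ α β → α ≢ 0ℚ → ¬ IsTrivial (Fpoly ∘ₚ lin α β) (Gpoly ∘ₚ lin α β)
F∘lin-G∘lin-nontrivial α β α≢0 (f₁ , g₁ , h , deg-h≥2 , F≈f₁∘h , G≈g₁∘h) = α≢0 (lincomb₃ F₁ G₁ a₁≡b₁ (- 1ℚ) 1ℚ (- h₁)
  (solve 5 (λ α β a₁ b₁ h₁ → α :- con 0ℚ
     := (:- con 1ℚ) :* (α :* (β :- con ½) :- a₁ :* h₁) :+ con 1ℚ :* (α :* (β :+ con ½) :- b₁ :* h₁) :+ (:- h₁) :* (a₁ :- b₁))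
     refl α β a₁ b₁ h₁))
  where
  ½≢0 : ½ ≢ 0ℚ
  ½≢0 ()
  ½α²≢0 : ½ * (α * α) ≢ 0ℚ
  ½α²≢0 = x≢0∧y≢0⇒x*y≢0 ½≢0 (x≢0∧y≢0⇒x*y≢0 α≢0 α≢0)
  f₁∧h-deg : HasDegree f₁ 1 × HasDegree h 2
  f₁∧h-deg = linear∘quadratic-degrees (Fpoly ∘ₚ lin α β) f₁ h
    (HasDegree-resp-≋ (≋-sym (F∘lin α β)) (HasDegree-quadratic ½α²≢0)) (from≈ F≈f₁∘h) deg-h≥2
  g₁-deg : HasDegree g₁ 1
  g₁-deg = proj₁ (linear∘quadratic-degrees (Gpoly ∘ₚ lin α β) g₁ h
    (HasDegree-resp-≋ (≋-sym (G∘lin α β)) (HasDegree-quadratic ½α²≢0)) (from≈ G≈g₁∘h) deg-h≥2)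
  h-deg : HasDegree h 2
  h-deg = proj₂ f₁∧h-deg
  a₁ b₁ h₁ h₂ : ℚ
  a₁ = coeff f₁ 1
  b₁ = coeff g₁ 1
  h₁ = coeff h 1
  h₂ = coeff h 2
  F≋ : ½ * (β * β - β + 1ℚ) ∷ α * (β - ½) ∷ ½ * (α * α) ∷ [] ≋ coeff f₁ 0 + a₁ * coeff h 0 ∷ a₁ * h₁ ∷ a₁ * h₂ ∷ []
  F≋ = ≋-trans (≋-sym (F∘lin α β)) (≋-trans (from≈ F≈f₁∘h) (linear∘quadratic-coeffs f₁ h (proj₁ f₁∧h-deg) h-deg))
  G≋ : ½ * (β * β + β + 1ℚ) ∷ α * (β + ½) ∷ ½ * (α * α) ∷ [] ≋ coeff g₁ 0 + b₁ * coeff h 0 ∷ b₁ * h₁ ∷ b₁ * h₂ ∷ []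
  G≋ = ≋-trans (≋-sym (G∘lin α β)) (≋-trans (from≈ G≈g₁∘h) (linear∘quadratic-coeffs g₁ h g₁-deg h-deg))
  F₁ : α * (β - ½) ≡ a₁ * h₁
  F₁ = to≈ F≋ 1
  G₁ : α * (β + ½) ≡ b₁ * h₁
  G₁ = to≈ G≋ 1
  a₁≡b₁ : a₁ ≡ b₁
  a₁≡b₁ = *-cancelˡ-≡ h₂ (proj₁ h-deg) (begin
    h₂ * a₁      ≡⟨ ℚ.*-comm h₂ a₁ ⟩
    a₁ * h₂      ≡⟨ to≈ F≋ 2 ⟨
    ½ * (α * α)  ≡⟨ to≈ G≋ 2 ⟩
    b₁ * h₂      ≡⟨ ℚ.*-comm b₁ h₂ ⟩
    h₂ * b₁      ∎)

[F³+1]/G : Poly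
[F³+1]/G = + 9 / 4 ∷ - (+ 3 / 1) ∷ + 9 / 4 ∷ - 1ℚ ∷ + 1 / 4 ∷ []

[G³+1]/F : Poly
[G³+1]/F = + 9 / 4 ∷ + 3 / 1 ∷ + 9 / 4 ∷ 1ℚ ∷ + 1 / 4 ∷ []

cube∘lin+1ₛ : Poly → ∀ {n} → Polynomial n → Polynomial n → List (Polynomial n)
cube∘lin+1ₛ p α β = let p∘lin = ⌜ p ⌝ ∘ₛ (β ∷ α ∷ []) in p∘lin ⊛ₛ p∘lin ⊛ₛ p∘lin ⊕ₛ ⌜ one ⌝

product∘linₛ : Poly → Poly → ∀ {n} → Polynomial n → Polynomial n → List (Polynomial n)
product∘linₛ p q α β = (⌜ p ⌝ ∘ₛ (β ∷ α ∷ [])) ⊛ₛ (⌜ q ⌝ ∘ₛ (β ∷ α ∷ []))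

G∘lin∣F∘lin³+1 : ∀ α β → Gpoly ∘ₚ lin α β ∣ₚ cube (Fpoly ∘ₚ lin α β) ⊕ one
G∘lin∣F∘lin³+1 α β = [F³+1]/G ∘ₚ lin α β , λ
  { 0 → solve 2 (λ α β → coeffₛ (cube∘lin+1ₛ Fpoly α β) 0 := coeffₛ (product∘linₛ Gpoly [F³+1]/G α β) 0) refl α β
  ; 1 → solve 2 (λ α β → coeffₛ (cube∘lin+1ₛ Fpoly α β) 1 := coeffₛ (product∘linₛ Gpoly [F³+1]/G α β) 1) refl α β
  ; 2 → solve 2 (λ α β → coeffₛ (cube∘lin+1ₛ Fpoly α β) 2 := coeffₛ (product∘linₛ Gpoly [F³+1]/G α β) 2) refl α β
  ; 3 → solve 2 (λ α β → coeffₛ (cube∘lin+1ₛ Fpoly α β) 3 := coeffₛ (product∘linₛ Gpoly [F³+1]/G α β) 3) refl α β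
  ; 4 → solve 2 (λ α β → coeffₛ (cube∘lin+1ₛ Fpoly α β) 4 := coeffₛ (product∘linₛ Gpoly [F³+1]/G α β) 4) refl α β
  ; 5 → solve 2 (λ α β → coeffₛ (cube∘lin+1ₛ Fpoly α β) 5 := coeffₛ (product∘linₛ Gpoly [F³+1]/G α β) 5) refl α β
  ; 6 → solve 2 (λ α β → coeffₛ (cube∘lin+1ₛ Fpoly α β) 6 := coeffₛ (product∘linₛ Gpoly [F³+1]/G α β) 6) refl α β
  ; 7 → solve 2 (λ α β → coeffₛ (cube∘lin+1ₛ Fpoly α β) 7 := coeffₛ (product∘linₛ Gpoly [F³+1]/G α β) 7) refl α β
  ; 8 → solve 2 (λ α β → coeffₛ (cube∘lin+1ₛ Fpoly α β) 8 := coeffₛ (product∘linₛ Gpoly [F³+1]/G α β) 8) refl α β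
  ; 9 → solve 2 (λ α β → coeffₛ (cube∘lin+1ₛ Fpoly α β) 9 := coeffₛ (product∘linₛ Gpoly [F³+1]/G α β) 9) refl α β
  ; (suc (suc (suc (suc (suc (suc (suc (suc (suc (suc _)))))))))) → refl
  }

F∘lin∣G∘lin³+1 : ∀ α β → Fpoly ∘ₚ lin α β ∣ₚ cube (Gpoly ∘ₚ lin α β) ⊕ one
F∘lin∣G∘lin³+1 α β = [G³+1]/F ∘ₚ lin α β , λ
  { 0 → solve 2 (λ α β → coeffₛ (cube∘lin+1ₛ Gpoly α β) 0 := coeffₛ (product∘linₛ Fpoly [G³+1]/F α β) 0) refl α β
  ; 1 → solve 2 (λ α β → coeffₛ (cube∘lin+1ₛ Gpoly α β) 1 := coeffₛ (product∘linₛ Fpoly [G³+1]/F α β) 1) refl α β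
  ; 2 → solve 2 (λ α β → coeffₛ (cube∘lin+1ₛ Gpoly α β) 2 := coeffₛ (product∘linₛ Fpoly [G³+1]/F α β) 2) refl α β
  ; 3 → solve 2 (λ α β → coeffₛ (cube∘lin+1ₛ Gpoly α β) 3 := coeffₛ (product∘linₛ Fpoly [G³+1]/F α β) 3) refl α β
  ; 4 → solve 2 (λ α β → coeffₛ (cube∘lin+1ₛ Gpoly α β) 4 := coeffₛ (product∘linₛ Fpoly [G³+1]/F α β) 4) refl α β
  ; 5 → solve 2 (λ α β → coeffₛ (cube∘lin+1ₛ Gpoly α β) 5 := coeffₛ (product∘linₛ Fpoly [G³+1]/F α β) 5) refl α β
  ; 6 → solve 2 (λ α β → coeffₛ (cube∘lin+1ₛ Gpoly α β) 6 := coeffₛ (product∘linₛ Fpoly [G³+1]/F α β) 6) refl α β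
  ; 7 → solve 2 (λ α β → coeffₛ (cube∘lin+1ₛ Gpoly α β) 7 := coeffₛ (product∘linₛ Fpoly [G³+1]/F α β) 7) refl α β
  ; 8 → solve 2 (λ α β → coeffₛ (cube∘lin+1ₛ Gpoly α β) 8 := coeffₛ (product∘linₛ Fpoly [G³+1]/F α β) 8) refl α β
  ; 9 → solve 2 (λ α β → coeffₛ (cube∘lin+1ₛ Gpoly α β) 9 := coeffₛ (product∘linₛ Fpoly [G³+1]/F α β) 9) refl α β
  ; (suc (suc (suc (suc (suc (suc (suc (suc (suc (suc _)))))))))) → refl
  }

F∘lin-G∘lin-nontrivial-solution : ∀ f g α β → α ≢ 0ℚ → f ≈ Fpoly ∘ₚ lin α β → g ≈ Gpoly ∘ₚ lin α β →
  IsSolution f g × ¬ IsTrivial f g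
F∘lin-G∘lin-nontrivial-solution f g α β α≢0 f≈F∘lin g≈G∘lin =
  IsSolution-resp-≋ (≋-sym f≋) (≋-sym g≋) (G∘lin∣F∘lin³+1 α β , F∘lin∣G∘lin³+1 α β) ,
  F∘lin-G∘lin-nontrivial α β α≢0 ∘ IsTrivial-resp-≋ f≋ g≋
  where
  f≋ : f ≋ Fpoly ∘ₚ lin α β
  f≋ = from≈ f≈F∘lin
  g≋ : g ≋ Gpoly ∘ₚ lin α β
  g≋ = from≈ g≈G∘lin

theorem2p1 : (f g : Poly) → HasDegree f 2 → HasDegree g 2 →
    (IsSolution f g × ¬ IsTrivial f g) ⇔
    (Σ ℚ λ α → Σ ℚ λ β → α ≢ 0ℚ × (f ≈ Fpoly ∘ₚ lin α β) × (g ≈ Gpoly ∘ₚ lin α β))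
theorem2p1 f g f-deg g-deg = mk⇔
  (λ (solution , nontrivial) → nontrivial-solution-form f g f-deg g-deg solution nontrivial)
  (λ (α , β , α≢0 , f≈F∘lin , g≈G∘lin) → F∘lin-G∘lin-nontrivial-solution f g α β α≢0 f≈F∘lin g≈G∘lin)
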